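{- Let $N\ge1$, let $m$ be a positive divisor of $N$, and let $g=\begin{pmatrix}A&B\\C&D\end{pmatrix}\in\mathrm{SL}_2(\mathbb{Z})$. For $u\in\mathbb{Z}$ put \[ M_u=\mathrm{lcm}\left(\frac{N}{\gcd(C(uC+D),N)},\ \frac{m}{\gcd(C(uA+B),m)}\right) \] (this is the integer $\mathrm{lcm}(N/\gcd(C D_u,N), m/\gcd(B_uC,m))$ attached to the matrix $gT^u=\begin{pmatrix}A&B_u\\C&D_u\end{pmatrix}$, $T=\begin{pmatrix}1&1\\0&1\end{pmatrix}$). Let $N_C=\prod_{p\mid C}p^{v_p(N)}$ and $m_{\overline C}=m/\prod_{p\mid C}p^{v_p(m)}$. Then the minimum of $M_u$ over $u\in\mathbb{Z}$ is \[ M'=\frac{N_C}{\gcd(C,N)}\cdot m_{\overline C}, \] and this minimum is attained for every $u$ such that $N/N_C$ divides $uC+D$.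
   Context: $v_p$ denotes the $p$-adic valuation. In the paper, $m$ is the conductor of the Nebentypus character of a modular form on $\Gamma_0(N)$, and $M_u$ is the integer $M$ governing the coefficient field $K_f(\zeta_M)$ of $f|_k gT^u$. -}

module Defs where

open import Data.Nat using (ℕ; zero; suc; _*_; _^_; _/_)
open import Data.Nat.Divisibility using (_∣?_)
open import Data.Nat.Primality using (prime?)
open import Data.Nat.GCD using (gcd)
open import Data.Nat.LCM using (lcm)
open import Data.List using (List; map; filter; upTo)
open import Data.Nat.ListAction using (product)
open import Data.Integer using (ℤ; ∣_∣)
open import Relation.Nullary using (yes; no)
open import Relation.Nullary.Decidable using (_×-dec_)

-- Truncated division on ℕ: a div b = ⌊a/b⌋ for b ≠ 0, and 0 for b = 0.
-- (Only ever applied below with nonzero divisors; in the statement all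
-- divisions are exact, as in the paper.)
_div_ : ℕ → ℕ → ℕ
a div zero    = zero
a div (suc b) = a / suc b

-- p-adic valuation with fuel: v_p(n) for p ≥ 2, n ≥ 1 (fuel n suffices).
vp-aux : ℕ → ℕ → ℕ → ℕ
vp-aux zero    p n = zero
vp-aux (suc f) p zero = zero
vp-aux (suc f) zero (suc n) = zero
vp-aux (suc f) (suc zero) (suc n) = zero
vp-aux (suc f) (suc (suc q)) (suc n) with suc (suc q) ∣? suc n
... | yes _ = suc (vp-aux f (suc (suc q)) (suc n / suc (suc q)))
... | no  _ = zero

vp : ℕ → ℕ → ℕ
vp p n = vp-aux n p n

-- ∏_{p prime, p ∣ c} p^{v_p(n)}.  Primes p > n contribute p^0 = 1, so
-- it suffices to range over primes p ≤ n.
primePart : ℤ → ℕ → ℕ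
primePart c n =
  product (map (λ p → p ^ vp p n)
               (filter (λ p → prime? p ×-dec (p ∣? ∣ c ∣)) (upTo (suc n))))

Mu : (N m : ℕ) (A B C D u : ℤ) → ℕ
Mu N m A B C D u =
  lcm (N div gcd ∣ C Data.Integer.* (u Data.Integer.* C Data.Integer.+ D) ∣ N)
      (m div gcd ∣ C Data.Integer.* (u Data.Integer.* A Data.Integer.+ B) ∣ m)

-- M' = (N_C / gcd(C,N)) · m_{C̄},  N_C = primePart C N,  m_{C̄} = m / primePart C m
M' : (N m : ℕ) (C : ℤ) → ℕ
M' N m C = (primePart C N div gcd ∣ C ∣ N) * (m div primePart C m)

module Submission where

-- Write c = ∣C∣, d = ∣uC+D∣, b = ∣uA+B∣, and split N = N_C · Q and m = m_C · m_C̄, where the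
-- first factors only involve primes of c and the second ones are coprime to c. Since gTᵘ has
-- determinant 1, d is coprime to c and to b. Hence N_C / gcd(c,N) divides N / gcd(cd,N)
-- (N_C is coprime to d), and m_C̄ divides L = M_u because it divides both L·d and L·b; the two
-- are coprime, so M' divides M_u. If Q ∣ uC+D, then Q·gcd(c,N) divides gcd(cd,N) and
-- gcd(c,m_C) divides gcd(cb,m), which gives the reverse divisibility. Finally Q is coprime
-- to C, so Bézout provides such a u.

module ℕ-Arithmetic where

  open import Defs
  open import Data.Nat
  open import Data.Nat.Properties
  open import Data.Nat.Divisibility
  open import Data.Nat.DivMod using (m/n*n≡m; m*[n/m]≡n; m*n/n≡m; m≥n⇒m/n>0; m/n<m)
  open import Data.Nat.GCD
  open import Data.Nat.LCM
  open import Data.Nat.Coprimality using (Coprime; coprime-divisor; coprime-factors; 1-coprimeTo)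
  import Data.Nat.Coprimality as Coprime
  open import Data.Nat.Primality
  open import Data.Nat.Primality.Factorisation using (factorise)
  open import Data.Nat.ListAction using (product)
  open import Data.Integer using (ℤ; ∣_∣)
  open import Data.List using ([]; _∷_; map; filter; upTo)
  open import Data.List.Relation.Unary.All as All using (All; []; _∷_)
  open import Data.List.Relation.Unary.All.Properties using (all-filter)
  open import Data.List.Relation.Unary.AllPairs using ([]; _∷_)
  open import Data.List.Relation.Unary.Unique.Propositional using (Unique)
  open import Data.List.Relation.Unary.Unique.Propositional.Properties using (upTo⁺; filter⁺)
  open import Data.List.Membership.Propositional using (_∈_)
  open import Data.List.Membership.Propositional.Properties using (∈-filter⁺; ∈-upTo⁺)
  open import Data.Product using (∃; _×_; _,_; proj₁; proj₂)
  open import Data.Sum using (inj₁; inj₂)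
  open import Data.Empty using (⊥-elim)
  open import Relation.Nullary using (¬_; Dec; yes; no)
  open import Relation.Nullary.Decidable using (_×-dec_)
  open import Relation.Binary.PropositionalEquality
  open import Algebra.Properties.CommutativeSemigroup *-commutativeSemigroup

  m-div-n*n≡m : ∀ {m n} → n ∣ m → m div n * n ≡ m
  m-div-n*n≡m {n = zero}  0∣m = sym (0∣⇒≡0 0∣m)
  m-div-n*n≡m {n = suc _} n∣m = m/n*n≡m n∣m

  div-unique : ∀ {m n q} .{{_ : NonZero n}} → q * n ≡ m → m div n ≡ q
  div-unique {n = suc n} {q} refl = m*n/n≡m q (suc n)

  nonZero-*ˡ : ∀ {m n o} .{{_ : NonZero o}} → m * n ≡ o → NonZero m
  nonZero-*ˡ {m} {n} {o} m*n≡o =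
    m*n≢0⇒m≢0 m {{≢-nonZero (λ m*n≡0 → ≢-nonZero⁻¹ o (trans (sym m*n≡o) m*n≡0))}}

  nonZero-*ʳ : ∀ {m n o} .{{_ : NonZero o}} → m * n ≡ o → NonZero n
  nonZero-*ʳ {m} {n} m*n≡o = nonZero-*ˡ (trans (*-comm n m) m*n≡o)

  nonZero-∣ : ∀ {m n} .{{_ : NonZero n}} → m ∣ n → NonZero m
  nonZero-∣ {m} (divides q n≡q*m) = nonZero-*ʳ {q} {m} (sym n≡q*m)

  gcd≢0ʳ : ∀ m n .{{_ : NonZero n}} → NonZero (gcd m n)
  gcd≢0ʳ m n = ≢-nonZero (λ gcd≡0 → ≢-nonZero⁻¹ n (gcd[m,n]≡0⇒n≡0 m gcd≡0))

  lcm≢0 : ∀ m n .{{_ : NonZero m}} .{{_ : NonZero n}} → NonZero (lcm m n)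
  lcm≢0 m n = nonZero-*ʳ {gcd m n} {{m*n≢0 m n}} (gcd*lcm m n)

  ∣*gcd : ∀ {a} x m n → a ∣ x * m → a ∣ x * n → a ∣ x * gcd m n
  ∣*gcd x m n a∣xm a∣xn =
    subst (_ ∣_) (sym (c*gcd[m,n]≡gcd[cm,cn] x m n)) (gcd-greatest a∣xm a∣xn)

  coprime-∣ˡ : ∀ {m n d} → Coprime m n → d ∣ m → Coprime d n
  coprime-∣ˡ m⊥n d∣m (e∣d , e∣n) = m⊥n (∣-trans e∣d d∣m , e∣n)

  coprime-∣ʳ : ∀ {m n d} → Coprime m n → d ∣ n → Coprime m d
  coprime-∣ʳ m⊥n d∣n (e∣m , e∣d) = m⊥n (e∣m , ∣-trans e∣d d∣n)

  coprime-*ʳ : ∀ {m n o} → Coprime m n → Coprime m o → Coprime m (n * o)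
  coprime-*ʳ m⊥n m⊥o (e∣m , e∣no) = m⊥o (e∣m , coprime-divisor (coprime-∣ˡ m⊥n e∣m) e∣no)

  coprime-^ʳ : ∀ {m n} k → Coprime m n → Coprime m (n ^ k)
  coprime-^ʳ {m} zero    m⊥n = Coprime.sym (1-coprimeTo m)
  coprime-^ʳ     (suc k) m⊥n = coprime-*ʳ m⊥n (coprime-^ʳ k m⊥n)

  coprime-^ : ∀ {m n} j k → Coprime m n → Coprime (m ^ j) (n ^ k)
  coprime-^ j k m⊥n = Coprime.sym (coprime-^ʳ j (Coprime.sym (coprime-^ʳ k m⊥n)))

  coprime⇒*∣ : ∀ {m n o} → Coprime m n → m ∣ o → n ∣ o → m * n ∣ o
  coprime⇒*∣ {m} {n} m⊥n (divides q o≡q*m) n∣o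
    with divides r q≡r*n ← coprime-divisor (Coprime.sym m⊥n) (subst (n ∣_) (trans o≡q*m (*-comm q m)) n∣o) =
    divides r (trans o≡q*m (trans (cong (_* m) q≡r*n) (trans (*-assoc r n m) (cong (r *_) (*-comm n m)))))

  prime-≢⇒coprime : ∀ {p q} → Prime p → Prime q → p ≢ q → Coprime p q
  prime-≢⇒coprime p-prime q-prime p≢q (d∣p , d∣q) with prime⇒irreducible p-prime d∣p
  ... | inj₁ d≡1 = d≡1
  ... | inj₂ refl with prime⇒irreducible q-prime d∣q
  ...   | inj₁ p≡1    = ⊥-elim (nonTrivial⇒≢1 {{prime⇒nonTrivial p-prime}} p≡1)
  ...   | inj₂ p≡q    = ⊥-elim (p≢q p≡q)

  ∃prime∣ : ∀ n .{{_ : NonZero n}} → n ≢ 1 → ∃ λ p → Prime p × p ∣ n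
  ∃prime∣ n n≢1 with factorise n
  ... | record { factors = [] ; isFactorisation = n≡1 } = ⊥-elim (n≢1 n≡1)
  ... | record { factors = p ∷ ps ; isFactorisation = n≡p*∏ ; factorsPrime = p-prime ∷ _ } =
    p , p-prime , subst (p ∣_) (sym n≡p*∏) (m∣m*n (product ps))

  ¬common-prime⇒coprime : ∀ {m n} .{{_ : NonZero m}} →
                          (∀ {p} → Prime p → p ∣ m → ¬ p ∣ n) → Coprime m n
  ¬common-prime⇒coprime {m} no-common {d} (d∣m , d∣n) with d ≟ 1
  ... | yes d≡1 = d≡1
  ... | no d≢1 with p , p-prime , p∣d ← ∃prime∣ d {{nonZero-∣ d∣m}} d≢1 =
    ⊥-elim (no-common p-prime (∣-trans p∣d d∣m) (∣-trans p∣d d∣n))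

  SupportedOn : ℕ → ℕ → Set
  SupportedOn P c = ∀ {x} → Coprime x c → Coprime x P

  vp-aux-∣ : ∀ fuel q n → 2+ q ^ vp-aux fuel (2+ q) n ∣ n
  vp-aux-∣ zero       q n       = 1∣ n
  vp-aux-∣ (suc fuel) q zero    = 1∣ zero
  vp-aux-∣ (suc fuel) q (suc n) with 2+ q ∣? suc n
  ... | yes p∣n = subst (λ k → 2+ q * 2+ q ^ vp-aux fuel (2+ q) (suc n / 2+ q) ∣ k) (m*[n/m]≡n p∣n)
                        (*-monoʳ-∣ (2+ q) (vp-aux-∣ fuel q (suc n / 2+ q)))
  ... | no  _   = 1∣ suc n

  vp-aux-maximal : ∀ fuel q n .{{_ : NonZero n}} → n ≤ fuel →
                   ¬ 2+ q ^ suc (vp-aux fuel (2+ q) n) ∣ n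
  vp-aux-maximal (suc fuel) q (suc n) (s≤s n≤fuel) with 2+ q ∣? suc n
  ... | yes p∣n = λ p^v+2∣n →
    vp-aux-maximal fuel q (suc n / 2+ q) {{>-nonZero (m≥n⇒m/n>0 (∣⇒≤ p∣n))}}
      (<⇒≤pred (≤-trans (m/n<m (suc n) (2+ q) (s≤s (s≤s z≤n))) (s≤s n≤fuel)))
      (*-cancelˡ-∣ (2+ q) (subst (λ k → 2+ q * 2+ q ^ suc (vp-aux fuel (2+ q) (suc n / 2+ q)) ∣ k)
                                 (sym (m*[n/m]≡n p∣n)) p^v+2∣n))
  ... | no  p∤n = λ p∣n → p∤n (subst (_∣ suc n) (*-identityʳ (2+ q)) p∣n)

  pPart : ℕ → ℕ → ℕ
  pPart n p = p ^ vp p n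

  pPart∣ : ∀ {p} n → Prime p → pPart n p ∣ n
  pPart∣ {2+ q} n _ = vp-aux-∣ n q n

  p*pPart∤ : ∀ {p} n .{{_ : NonZero n}} → Prime p → ¬ p * pPart n p ∣ n
  p*pPart∤ {2+ q} n _ = vp-aux-maximal n q n ≤-refl

  coprime-pPart-∏ : ∀ n {p ps} → Prime p → All Prime ps → All (p ≢_) ps →
                    Coprime (pPart n p) (product (map (pPart n) ps))
  coprime-pPart-∏ n {p} p-prime []                 []              = Coprime.sym (1-coprimeTo (pPart n p))
  coprime-pPart-∏ n {p} p-prime (q-prime ∷ qs-prime) (p≢q ∷ p∉qs) =
    coprime-*ʳ (coprime-^ (vp p n) (vp _ n) (prime-≢⇒coprime p-prime q-prime p≢q))
               (coprime-pPart-∏ n p-prime qs-prime p∉qs)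

  ∏pPart-split : ∀ n .{{_ : NonZero n}} {ps} → Unique ps → All Prime ps →
                 ∃ λ r → product (map (pPart n) ps) * r ≡ n × All (λ p → ¬ p ∣ r) ps
  ∏pPart-split n []              []                 = n , *-identityˡ n , []
  ∏pPart-split n {p ∷ ps} (p∉ps ∷ ps-unique) (p-prime ∷ ps-prime)
    with r , ∏*r≡n , ps∤r ← ∏pPart-split n ps-unique ps-prime
    with divides s r≡s*pp ← coprime-divisor (coprime-pPart-∏ n p-prime ps-prime p∉ps)
                                           (subst (pPart n p ∣_) (sym ∏*r≡n) (pPart∣ n p-prime))
    = s , pp*∏*s≡n , p∤s ∷ All.map (λ q∤r q∣s → q∤r (∣-trans q∣s s∣r)) ps∤r
    where
    pp ∏ : ℕ
    pp = pPart n p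
    ∏ = product (map (pPart n) ps)
    s∣r : s ∣ r
    s∣r = divides pp (trans r≡s*pp (*-comm s pp))
    pp*∏*s≡n : pp * ∏ * s ≡ n
    pp*∏*s≡n = trans (xy∙z≈y∙zx pp ∏ s) (trans (cong (∏ *_) (sym r≡s*pp)) ∏*r≡n)
    p∤s : ¬ p ∣ s
    p∤s p∣s = p*pPart∤ n p-prime (∣-trans (subst (_ ∣_) (sym r≡s*pp) (*-monoˡ-∣ pp p∣s))
                                           (subst (r ∣_) ∏*r≡n (n∣m*n ∏)))

  primeDivisor? : ∀ c p → Dec (Prime p × p ∣ c)
  primeDivisor? c p = prime? p ×-dec (p ∣? c)

  ∏pPart-supportedOn : ∀ n {c ps} → All (_∣ c) ps → SupportedOn (product (map (pPart n) ps)) c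
  ∏pPart-supportedOn n         []          x⊥c = Coprime.sym (1-coprimeTo _)
  ∏pPart-supportedOn n {ps = p ∷ _} (p∣c ∷ ps∣c) x⊥c =
    coprime-*ʳ (coprime-^ʳ (vp p n) (coprime-∣ʳ x⊥c p∣c)) (∏pPart-supportedOn n ps∣c x⊥c)

  primePart-supportedOn : ∀ C n → SupportedOn (primePart C n) ∣ C ∣
  primePart-supportedOn C n =
    ∏pPart-supportedOn n (All.map proj₂ (all-filter (primeDivisor? ∣ C ∣) (upTo (suc n))))

  primePart-complement : ∀ C n .{{_ : NonZero n}} →
                         ∃ λ q → primePart C n * q ≡ n × Coprime q ∣ C ∣
  primePart-complement C n
    with r , P*r≡n , primes∤r ← ∏pPart-split n (filter⁺ (primeDivisor? ∣ C ∣) (upTo⁺ (suc n)))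
                                  (All.map proj₁ (all-filter (primeDivisor? ∣ C ∣) (upTo (suc n))))
    = r , P*r≡n , ¬common-prime⇒coprime {{nonZero-*ʳ {primePart C n} P*r≡n}} no-common-prime
    where
    no-common-prime : ∀ {p} → Prime p → p ∣ r → ¬ p ∣ ∣ C ∣
    no-common-prime {p} p-prime p∣r p∣c = All.lookup primes∤r p∈primes p∣r
      where
      p∣n : p ∣ n
      p∣n = ∣-trans p∣r (divides (primePart C n) (sym P*r≡n))
      p∈primes : p ∈ filter (primeDivisor? ∣ C ∣) (upTo (suc n))
      p∈primes = ∈-filter⁺ (primeDivisor? ∣ C ∣) (∈-upTo⁺ (s≤s (∣⇒≤ p∣n))) (p-prime , p∣c)

  primePart-cofactor : ∀ C n .{{_ : NonZero n}} →
                       primePart C n * (n div primePart C n) ≡ n × Coprime (n div primePart C n) ∣ C ∣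
  primePart-cofactor C n with q , P*q≡n , q⊥c ← primePart-complement C n
    rewrite div-unique {n} {primePart C n} {q} {{nonZero-*ˡ P*q≡n}} (trans (*-comm q _) P*q≡n)
    = P*q≡n , q⊥c

  -- Applied with c = ∣C∣, d = ∣uC+D∣, b = ∣uA+B∣, P = N_C and Pm = m_C; then L = M_u.
  module LcmBound {N m c d b P Q Pm Qm : ℕ} .{{_ : NonZero N}} (m∣N : m ∣ N)
                  (P*Q≡N : P * Q ≡ N) (Pm*Qm≡m : Pm * Qm ≡ m)
                  (P-supp : SupportedOn P c) (Pm-supp : SupportedOn Pm c)
                  (Q⊥c : Coprime Q c) (Qm⊥c : Coprime Qm c)
                  (d⊥c : Coprime d c) (d⊥b : Coprime d b) where

    G h k X Y P′ : ℕ
    G = gcd c N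
    h = gcd (c * d) N
    k = gcd (c * b) m
    X = N div h
    Y = m div k
    P′ = P div G

    X*h≡N : X * h ≡ N
    X*h≡N = m-div-n*n≡m (gcd[m,n]∣n (c * d) N)

    Y*k≡m : Y * k ≡ m
    Y*k≡m = m-div-n*n≡m (gcd[m,n]∣n (c * b) m)

    instance
      m≢0 : NonZero m
      m≢0 = nonZero-∣ m∣N
      G≢0 : NonZero G
      G≢0 = gcd≢0ʳ c N
      k≢0 : NonZero k
      k≢0 = gcd≢0ʳ (c * b) m
      Q≢0 : NonZero Q
      Q≢0 = nonZero-*ʳ {P} P*Q≡N
      X≢0 : NonZero X
      X≢0 = nonZero-*ˡ {X} X*h≡N
      Y≢0 : NonZero Y
      Y≢0 = nonZero-*ˡ {Y} Y*k≡m

    P∣N : P ∣ N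
    P∣N = divides Q (trans (sym P*Q≡N) (*-comm P Q))

    G∣P : G ∣ P
    G∣P = coprime-divisor (Coprime.sym (coprime-∣ʳ Q⊥c (gcd[m,n]∣m c N)))
                          (subst (G ∣_) (sym (trans (*-comm Q P) P*Q≡N)) (gcd[m,n]∣n c N))

    P′*G≡P : P′ * G ≡ P
    P′*G≡P = m-div-n*n≡m G∣P

    Qm∣m : Qm ∣ m
    Qm∣m = divides Pm (sym Pm*Qm≡m)

    Pm∣m : Pm ∣ m
    Pm∣m = divides Qm (trans (sym Pm*Qm≡m) (*-comm Pm Qm))

    Pm∣P : Pm ∣ P
    Pm∣P = coprime-divisor (Coprime.sym (Pm-supp Q⊥c))
                           (subst (Pm ∣_) (sym (trans (*-comm Q P) P*Q≡N)) (∣-trans Pm∣m m∣N))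

    P′∣X : P′ ∣ X
    P′∣X = *-cancelʳ-∣ G (subst (_∣ X * G) (sym P′*G≡P) P∣X*G)
      where
      P∣d*[X*c] : P ∣ d * (X * c)
      P∣d*[X*c] = ∣-trans P∣N (subst₂ _∣_ X*h≡N (x∙yz≈z∙xy X c d) (*-monoʳ-∣ X (gcd[m,n]∣m (c * d) N)))
      P∣X*G : P ∣ X * G
      P∣X*G = ∣*gcd X c N (coprime-divisor (Coprime.sym (P-supp d⊥c)) P∣d*[X*c]) (∣n⇒∣m*n X P∣N)

    L : ℕ
    L = lcm X Y

    Qm∣L : Qm ∣ L
    Qm∣L = coprime-factors d⊥b (coprime-divisor Qm⊥c (∣-trans Qm∣m (∣-trans m∣N N∣c*[d*L])) ,
                                coprime-divisor Qm⊥c (∣-trans Qm∣m m∣c*[b*L]))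
      where
      N∣c*[d*L] : N ∣ c * (d * L)
      N∣c*[d*L] = subst₂ _∣_ X*h≡N (x∙yz≈y∙zx L c d) (*-pres-∣ (m∣lcm[m,n] X Y) (gcd[m,n]∣m (c * d) N))
      m∣c*[b*L] : m ∣ c * (b * L)
      m∣c*[b*L] = subst₂ _∣_ Y*k≡m (x∙yz≈y∙zx L c b) (*-pres-∣ (n∣lcm[m,n] X Y) (gcd[m,n]∣m (c * b) m))

    P′*Qm∣L : P′ * Qm ∣ L
    P′*Qm∣L = coprime⇒*∣ (Coprime.sym (coprime-∣ʳ (P-supp Qm⊥c) (divides G (trans (sym P′*G≡P) (*-comm P′ G)))))
                         (∣-trans P′∣X (m∣lcm[m,n] X Y)) Qm∣L

    P′*Qm≤L : P′ * Qm ≤ L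
    P′*Qm≤L = ∣⇒≤ {{lcm≢0 X Y}} P′*Qm∣L

    module _ (Q∣d : Q ∣ d) where

      X∣P′ : X ∣ P′
      X∣P′ = *-cancelʳ-∣ G (subst (X * G ∣_) (sym P′*G≡P) (*-cancelʳ-∣ Q X*G*Q∣P*Q))
        where
        Q*G∣h : Q * G ∣ h
        Q*G∣h = gcd-greatest (subst (Q * G ∣_) (*-comm d c) (*-pres-∣ Q∣d (gcd[m,n]∣m c N)))
                             (subst (Q * G ∣_) (trans (*-comm Q P) P*Q≡N) (*-monoʳ-∣ Q G∣P))
        X*G*Q∣P*Q : X * G * Q ∣ P * Q
        X*G*Q∣P*Q = subst₂ _∣_ (x∙yz≈xz∙y X Q G) (trans X*h≡N (sym P*Q≡N)) (*-monoʳ-∣ X Q*G∣h)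

      Y∣P′*Qm : Y ∣ P′ * Qm
      Y∣P′*Qm = *-cancelʳ-∣ k (subst₂ _∣_ (trans Pm*Qm≡m (sym Y*k≡m)) (xy∙z≈xz∙y P′ k Qm)
                                      (*-monoˡ-∣ Qm (∣-trans Pm∣P′*g (*-monoʳ-∣ P′ g∣k))))
        where
        g : ℕ
        g = gcd c Pm
        Pm*G∣P*g : Pm * G ∣ P * g
        Pm*G∣P*g = ∣*gcd P c Pm (*-pres-∣ Pm∣P (gcd[m,n]∣m c N))
                                (subst (_∣ P * Pm) (*-comm G Pm) (*-pres-∣ G∣P (∣-refl {Pm})))
        Pm∣P′*g : Pm ∣ P′ * g
        Pm∣P′*g = *-cancelʳ-∣ G (subst (Pm * G ∣_) (trans (cong (_* g) (sym P′*G≡P)) (xy∙z≈xz∙y P′ G g))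
                                       Pm*G∣P*g)
        g∣k : g ∣ k
        g∣k = gcd-greatest (∣m⇒∣m*n b (gcd[m,n]∣m c Pm)) (∣-trans (gcd[m,n]∣n c Pm) Pm∣m)

      L≡P′*Qm : L ≡ P′ * Qm
      L≡P′*Qm = ∣-antisym (lcm-least (∣-trans X∣P′ (m∣m*n Qm)) Y∣P′*Qm) P′*Qm∣L

open import Defs
open import Data.Nat using (ℕ; _≤_; _≥_)
open import Data.Nat.Divisibility using (_∣_)
open import Data.Integer using (ℤ; _*_; _+_; _-_; +_)
open import Data.Product using (_×_; ∃)
open import Relation.Binary.PropositionalEquality using (_≡_)
import Data.Integer.Divisibility as ℤDiv

open import Data.Nat.Base using (>-nonZero)
open import Data.Nat.Divisibility using (∣1⇒≡1)
open import Data.Nat.Coprimality using (Coprime; coprime-Bézout)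
open import Data.Nat.GCD using (gcd; module Bézout)
open import Data.Nat.LCM using (lcm)
open import Data.Integer using (-_; -[1+_]; -1ℤ; ∣_∣)
open import Data.Integer.Properties using (abs-*; pos-*; *-identityˡ; -1*i≡-i)
open import Data.Integer.Divisibility.Signed as Signed using (∣ᵤ⇒∣; ∣⇒∣ᵤ; ∣m∣n⇒∣m-n; ∣n⇒∣m*n; ∣m⇒∣m*n)
open import Data.Integer.Tactic.RingSolver using (solve-∀)
open import Data.Product using (∃₂; _,_; proj₁; proj₂)
import Data.Nat as ℕ
open import Relation.Binary.PropositionalEquality using (sym; trans; cong; cong₂; subst; module ≡-Reasoning)
open ℕ-Arithmetic using (primePart-cofactor; primePart-supportedOn; module LcmBound)

det[gTᵘ]≡det[g] : ∀ A B C D u → A * (u * C + D) - (u * A + B) * C ≡ A * D - B * C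
det[gTᵘ]≡det[g] = solve-∀

det≡1⇒coprime : ∀ a x y z → a * x - y * z ≡ + 1 → Coprime (∣ x ∣) (∣ y ∣) × Coprime (∣ x ∣) (∣ z ∣)
det≡1⇒coprime a x y z det≡1 =
  (λ {k} (k∣x , k∣y) → ∣det⇒≡1 (∣m∣n⇒∣m-n (∣n⇒∣m*n a (∣ᵤ⇒∣ {+ k} {x} k∣x)) (∣m⇒∣m*n z (∣ᵤ⇒∣ {+ k} {y} k∣y)))) ,
  (λ {k} (k∣x , k∣z) → ∣det⇒≡1 (∣m∣n⇒∣m-n (∣n⇒∣m*n a (∣ᵤ⇒∣ {+ k} {x} k∣x)) (∣n⇒∣m*n y (∣ᵤ⇒∣ {+ k} {z} k∣z))))
  where
  ∣det⇒≡1 : ∀ {k} → + k Signed.∣ a * x - y * z → k ≡ 1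
  ∣det⇒≡1 k∣det = ∣1⇒≡1 (∣⇒∣ᵤ (subst (_ Signed.∣_) det≡1 k∣det))

1+ab≡cd⇒ℤ : ∀ a b c d → 1 ℕ.+ a ℕ.* b ≡ c ℕ.* d → + 1 + + a * + b ≡ + c * + d
1+ab≡cd⇒ℤ a b c d eq = trans (cong (λ t → + 1 + t) (sym (pos-* a b))) (trans (cong +_ eq) (pos-* c d))

coprime⇒ℤ-Bézout : ∀ {m n} → Coprime m n → ∃₂ λ a b → a * + m + b * + n ≡ + 1
coprime⇒ℤ-Bézout {m} {n} m⊥n with coprime-Bézout m⊥n
... | Bézout.+- x y 1+y*n≡x*m = + x , - + y , (begin
  + x * + m + - + y * + n        ≡⟨ cong (_+ - + y * + n) (1+ab≡cd⇒ℤ y n x m 1+y*n≡x*m) ⟨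
  + 1 + + y * + n + - + y * + n  ≡⟨ 1+st-st≡1 (+ y) (+ n) ⟩
  + 1                            ∎)
  where
  open ≡-Reasoning
  1+st-st≡1 : ∀ s t → + 1 + s * t + - s * t ≡ + 1
  1+st-st≡1 = solve-∀
... | Bézout.-+ x y 1+x*m≡y*n = - + x , + y , (begin
  - + x * + m + + y * + n            ≡⟨ cong (λ t → - + x * + m + t) (1+ab≡cd⇒ℤ x m y n 1+x*m≡y*n) ⟨
  - + x * + m + (+ 1 + + x * + m)    ≡⟨ -st+[1+st]≡1 (+ x) (+ m) ⟩
  + 1                                ∎)
  where
  open ≡-Reasoning
  -st+[1+st]≡1 : ∀ s t → - s * t + (+ 1 + s * t) ≡ + 1
  -st+[1+st]≡1 = solve-∀

abs-as-multiple : ∀ i → ∃ λ s → s * i ≡ + ∣ i ∣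
abs-as-multiple (+ n)     = + 1 , *-identityˡ (+ n)
abs-as-multiple -[1+ n ]  = -1ℤ , -1*i≡-i -[1+ n ]

∃u[Q∣uC+D] : ∀ {Q} C D → Coprime Q (∣ C ∣) → ∃ λ u → + Q ℤDiv.∣ u * C + D
∃u[Q∣uC+D] {Q} C D Q⊥c
  with a , b , aQ+bc≡1 ← coprime⇒ℤ-Bézout Q⊥c
     | s , sC≡c ← abs-as-multiple C
  = - (D * b * s) , ∣⇒∣ᵤ (Signed.divides (D * a) (begin
    - (D * b * s) * C + D                    ≡⟨ expand D b s C ⟩
    D * (+ 1 - b * (s * C))                  ≡⟨ cong (λ t → D * (+ 1 - b * t)) sC≡c ⟩
    D * (+ 1 - b * + ∣ C ∣)                  ≡⟨ cong (λ t → D * (t - b * + ∣ C ∣)) aQ+bc≡1 ⟨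
    D * (a * + Q + b * + ∣ C ∣ - b * + ∣ C ∣)  ≡⟨ cancel D a (+ Q) b (+ ∣ C ∣) ⟩
    D * a * + Q                              ∎))
  where
  open ≡-Reasoning
  expand : ∀ D b s C → - (D * b * s) * C + D ≡ D * (+ 1 - b * (s * C))
  expand = solve-∀
  cancel : ∀ D a q b c → D * (a * q + b * c - b * c) ≡ D * a * q
  cancel = solve-∀

proposition6p1 : (N m : ℕ) → N ≥ 1 → m ≥ 1 → m ∣ N →
    (A B C D : ℤ) → A * D - B * C ≡ + 1 →
    ((u : ℤ) → M' N m C ≤ Mu N m A B C D u)
    × ((u : ℤ) → (+ (N div primePart C N)) ℤDiv.∣ (u * C + D) → Mu N m A B C D u ≡ M' N m C)
    × ∃ (λ u → Mu N m A B C D u ≡ M' N m C)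
proposition6p1 N m N≥1 m≥1 m∣N A B C D det≡1 =
  (λ u → subst (M' N m C ≤_) (sym (Mu≡L u)) (Bound.P′*Qm≤L u)) ,
  Mu≡M' ,
  (u₀ , Mu≡M' u₀ Q∣u₀C+D)
  where
  instance
    N≢0 : ℕ.NonZero N
    N≢0 = >-nonZero N≥1
  P Q Pm Qm : ℕ
  P = primePart C N
  Q = N div P
  Pm = primePart C m
  Qm = m div Pm
  P*Q≡N : P ℕ.* Q ≡ N
  P*Q≡N = proj₁ (primePart-cofactor C N)
  Q⊥c : Coprime Q ∣ C ∣
  Q⊥c = proj₂ (primePart-cofactor C N)
  Pm*Qm≡m : Pm ℕ.* Qm ≡ m
  Pm*Qm≡m = proj₁ (primePart-cofactor C m {{>-nonZero m≥1}})
  Qm⊥c : Coprime Qm ∣ C ∣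
  Qm⊥c = proj₂ (primePart-cofactor C m {{>-nonZero m≥1}})
  coprime-uC+D : ∀ u → Coprime (∣ u * C + D ∣) (∣ u * A + B ∣) × Coprime (∣ u * C + D ∣) (∣ C ∣)
  coprime-uC+D u = det≡1⇒coprime A (u * C + D) (u * A + B) C (trans (det[gTᵘ]≡det[g] A B C D u) det≡1)
  module Bound (u : ℤ) =
    LcmBound m∣N P*Q≡N Pm*Qm≡m (primePart-supportedOn C N) (primePart-supportedOn C m) Q⊥c Qm⊥c
             (proj₂ (coprime-uC+D u)) (proj₁ (coprime-uC+D u))
  Mu≡L : ∀ u → Mu N m A B C D u ≡ Bound.L u
  Mu≡L u = cong₂ (λ x y → lcm (N div gcd x N) (m div gcd y m)) (abs-* C (u * C + D)) (abs-* C (u * A + B))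
  Mu≡M' : ∀ u → + Q ℤDiv.∣ u * C + D → Mu N m A B C D u ≡ M' N m C
  Mu≡M' u Q∣uC+D = trans (Mu≡L u) (Bound.L≡P′*Qm u Q∣uC+D)
  u₀ : ℤ
  u₀ = proj₁ (∃u[Q∣uC+D] C D Q⊥c)
  Q∣u₀C+D : + Q ℤDiv.∣ u₀ * C + D
  Q∣u₀C+D = proj₂ (∃u[Q∣uC+D] C D Q⊥c)
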